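{- Let $c_n$ be the number of connected parking functions of length $n$. Then $$\sum_{n\ge1}c_nt^n=1-\Bigl(\sum_{n\ge0}(n+1)^{n-1}t^n\Bigr)^{ -1}.$$
   Context: A parking function of length $n$ is a word $a=a_1\cdots a_n$ with letters in $\{1,\dots,n\}$ whose nondecreasing rearrangement $a'_1\le\cdots\le a'_n$ satisfies $a'_i\le i$ for all $i$; there are $(n+1)^{n-1}$ of them. For words $u,v$ with $|u|=k$, the shifted concatenation is $u\bullet v=u\cdot v[k]$, where $v[k]$ is obtained from $v$ by adding $k$ to every letter. A word $w$ is connected if it cannot be written as $w=u\bullet v$ with $u,v$ nonempty words. -}

module Defs where

open import Data.Nat as ℕ using (ℕ; zero; suc; _≤_; _∸_; _^_)
open import Data.Nat.Properties using (≤-decTotalOrder)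
open import Data.Integer as ℤ using (ℤ; +_)
open import Data.List using (List; []; _∷_; _++_; length; map; foldr; upTo; lookup)
open import Data.List.Relation.Unary.All using (All)
open import Data.List.Relation.Unary.Unique.Propositional using (Unique)
open import Data.List.Membership.Propositional using (_∈_)
open import Data.List.Sort ≤-decTotalOrder using (sort)
open import Data.Fin using (Fin; toℕ)
open import Data.Product using (Σ; ∃; ∃₂; _×_)
open import Function.Bundles using (_⇔_)
open import Relation.Binary.PropositionalEquality using (_≡_; _≢_)
open import Relation.Nullary using (¬_)

Word : Set
Word = List ℕ

Positive : Word → Set
Positive = All (λ x → 1 ≤ x)

shift : ℕ → Word → Word
shift k v = map (k ℕ.+_) v

_•_ : Word → Word → Word
u • v = u ++ shift (length u) v

Connected : Word → Set
Connected w = ¬ (∃₂ λ u v → u ≢ [] × v ≢ [] × Positive u × Positive v × w ≡ u • v)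

IsParkingFunction : ℕ → Word → Set
IsParkingFunction n a =
  Σ (length a ≡ n) λ _ →
    All (λ x → 1 ≤ x × x ≤ n) a ×
    ((i : Fin (length (sort a))) → lookup (sort a) i ≤ suc (toℕ i))

IsNumberOfConnectedPF : ℕ → ℕ → Set
IsNumberOfConnectedPF n c =
  Σ (List Word) λ L →
    Unique L × (∀ w → (w ∈ L) ⇔ (IsParkingFunction n w × Connected w)) × length L ≡ c

Series : Set
Series = ℕ → ℤ

oneS : Series
oneS zero    = + 1
oneS (suc _) = + 0

_-S_ : Series → Series → Series
(f -S g) n = f n ℤ.- g n

_*S_ : Series → Series → Series
(f *S g) n = foldr ℤ._+_ (+ 0) (map (λ k → f k ℤ.* g (n ∸ k)) (upTo (suc n)))

-- g is the multiplicative inverse of f in ℤ[[t]] (two-sided, ℤ[[t]] commutative)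
IsInverse : Series → Series → Set
IsInverse f g = ∀ n → (f *S g) n ≡ oneS n

-- ∑_{n≥0} (n+1)^{n-1} t^n ; the n = 0 coefficient is 1^{-1} = 1
parkingSeries : Series
parkingSeries zero    = + 1
parkingSeries (suc m) = + ((m ℕ.+ 2) ^ m)

connSeries : (ℕ → ℕ) → Series
connSeries c zero    = + 0
connSeries c (suc m) = + c (suc m)

-- A word of length n over {1, …, n + 1} is a parking function iff, for every j ≤ n, at least j of its
-- letters are ≤ j.  Pollak's cycle argument: put N = n + 1 and L k = #{letters ≤ k} + (N − k); the
-- rotation x ↦ x + s (mod N) of a word parks exactly when N − s is the first minimiser of L on
-- {0, …, N}.  That minimiser exists, is unique, and is nonzero because L 0 = L N + 1, so exactly one of
-- the N rotations of each of the Nⁿ words parks; as each rotation permutes the words, N · pₙ = Nⁿ.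
-- A nonempty parking function factors uniquely as u • v with u a nonempty connected parking function
-- and v a parking function: split off prefixes while possible, and two connected prefixes of the same
-- word agree, since the longer one would split at the length of the shorter.  Sorting the factorisations
-- by |v| gives pₙ = ∑_{k<n} c_{n−k} p_k for n ≥ 1, which is the coefficientwise form of P (1 − C) = 1.

module Submission where

open import Defs
open import Data.Nat using (ℕ; zero; suc; _≤_; _<_; z≤n; s≤s; s≤s⁻¹; _≤?_; _<?_; _+_; _∸_; _*_; _^_)
open import Data.Nat.Properties
open import Data.Integer as ℤ using (ℤ)
import Data.Integer.Properties as ℤₚ
open import Data.Nat.Tactic.RingSolver using (solve-∀)
open import Data.List using (List; []; _∷_; _++_; length; map; lookup; filter; concat; cartesianProductWith; take; drop; applyUpTo; upTo; foldr; _∷ʳ_)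
open import Data.List.Properties using (length-++; length-map; map-++; map-∘; map-cong; map-upTo; upTo-∷ʳ; map-injective; map-id-local; length-take; length-drop; take++drop≡id; ++-assoc; ++-identityʳ; ++-cancelˡ; ∷-injectiveˡ; ∷-injectiveʳ)
open import Data.List.Relation.Unary.All as All using (All; []; _∷_)
open import Data.List.Relation.Unary.All.Properties using (map⁺; ++⁺; ++⁻ˡ; take⁺; applyUpTo⁺₂)
open import Data.List.Relation.Unary.Any using (here; there)
open import Data.List.Relation.Unary.Linked as Linked using (Linked)
open import Data.List.Relation.Unary.Linked.Properties using (Linked⇒AllPairs)
open import Data.List.Relation.Unary.AllPairs using (AllPairs; []; _∷_)
import Data.List.Relation.Unary.AllPairs.Properties as AllPairs
open import Data.List.Relation.Unary.Unique.Propositional using (Unique)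
import Data.List.Relation.Unary.Unique.Propositional.Properties as Unique
open import Data.List.Relation.Binary.Permutation.Propositional as Perm using (_↭_)
open import Data.List.Relation.Binary.Permutation.Propositional.Properties using (↭-length)
open import Data.List.Relation.Binary.Subset.Propositional using (_⊆_)
open import Data.List.Relation.Binary.Disjoint.Propositional using (Disjoint)
open import Data.List.Membership.Propositional using (_∈_)
open import Data.List.Membership.Propositional.Properties using (∈-∃++; ∈-++⁻; ∈-++⁺ˡ; ∈-++⁺ʳ; ∈-cartesianProductWith⁺; ∈-cartesianProductWith⁻; ∈-filter⁺; ∈-filter⁻; ∈-concat⁺′; ∈-concat⁻′; ∈-map⁺; ∈-map⁻; ∈-applyUpTo⁺; ∈-applyUpTo⁻; ∈-upTo⁻)
open import Data.List.Sort ≤-decTotalOrder using (sort; sort-↭; sort-↗)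
open import Data.Fin using (Fin; toℕ) renaming (zero to fzero; suc to fsuc)
open import Data.Product using (∃; ∃₂; _×_; _,_; proj₁; proj₂)
open import Relation.Binary.Definitions using (tri<; tri≈; tri>)
open import Data.Sum using (inj₁; inj₂)
open import Data.Unit using (⊤; tt)
open import Data.Empty using (⊥-elim)
open import Relation.Nullary using (Dec; yes; no; ¬_)
open import Relation.Nullary.Decidable using (_×-dec_; map′)
open import Relation.Binary.PropositionalEquality
open import Function using (_∘_)
open import Function.Bundles using (_⇔_; mk⇔; module Equivalence)
import Function.Properties.Equivalence as ⇔
open import Level using (0ℓ)
import Relation.Binary.Reasoning.Setoid (⇔.⇔-setoid 0ℓ) as ⇔-Reasoning
open import Algebra.Properties.CommutativeSemigroup +-commutativeSemigroup using (interchange; x∙yz≈y∙xz)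

private variable
  A B C : Set

-- Finite sums

𝟙 : ∀ {P : Set} → Dec P → ℕ
𝟙 (yes _) = 1
𝟙 (no _)  = 0

𝟙-yes : ∀ {P : Set} (P? : Dec P) → P → 𝟙 P? ≡ 1
𝟙-yes (yes _) _ = refl
𝟙-yes (no ¬p) p = ⊥-elim (¬p p)

𝟙-no : ∀ {P : Set} (P? : Dec P) → ¬ P → 𝟙 P? ≡ 0
𝟙-no (yes p) ¬p = ⊥-elim (¬p p)
𝟙-no (no _)  _  = refl

𝟙-cong : ∀ {P Q : Set} (P? : Dec P) (Q? : Dec Q) → P ⇔ Q → 𝟙 P? ≡ 𝟙 Q?
𝟙-cong (yes _) (yes _) _   = refl
𝟙-cong (yes p) (no ¬q) P⇔Q = ⊥-elim (¬q (Equivalence.to P⇔Q p))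
𝟙-cong (no ¬p) (yes q) P⇔Q = ⊥-elim (¬p (Equivalence.from P⇔Q q))
𝟙-cong (no _)  (no _)  _   = refl

∑ : (A → ℕ) → List A → ℕ
∑ f []       = 0
∑ f (x ∷ xs) = f x + ∑ f xs

infix 5 ∑ ∑<
syntax ∑ (λ x → e) xs = ∑[ x ∈ xs ] e

∑< : ℕ → (ℕ → ℕ) → ℕ
∑< zero    f = 0
∑< (suc n) f = ∑< n f + f n

syntax ∑< n (λ s → e) = ∑[ s < n ] e

∑-cong : ∀ {f g : A → ℕ} xs → (∀ x → x ∈ xs → f x ≡ g x) → ∑ f xs ≡ ∑ g xs
∑-cong []       f≗g = refl
∑-cong (x ∷ xs) f≗g = cong₂ _+_ (f≗g x (here refl)) (∑-cong xs (λ y y∈ → f≗g y (there y∈)))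

∑-const : ∀ (xs : List A) c → ∑[ _ ∈ xs ] c ≡ length xs * c
∑-const []       c = refl
∑-const (x ∷ xs) c = cong (c +_) (∑-const xs c)

∑-++ : ∀ (f : A → ℕ) xs ys → ∑ f (xs ++ ys) ≡ ∑ f xs + ∑ f ys
∑-++ f []       ys = refl
∑-++ f (x ∷ xs) ys = trans (cong (f x +_) (∑-++ f xs ys)) (sym (+-assoc (f x) _ _))

∑-map : ∀ (f : B → ℕ) (g : A → B) xs → ∑ f (map g xs) ≡ ∑ (f ∘ g) xs
∑-map f g []       = refl
∑-map f g (x ∷ xs) = cong (f (g x) +_) (∑-map f g xs)

∑-concat : ∀ (f : A → ℕ) xss → ∑ f (concat xss) ≡ ∑[ xs ∈ xss ] ∑ f xs
∑-concat f []         = refl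
∑-concat f (xs ∷ xss) = trans (∑-++ f xs (concat xss)) (cong (∑ f xs +_) (∑-concat f xss))

length-concat : ∀ (xss : List (List A)) → length (concat xss) ≡ ∑ length xss
length-concat []         = refl
length-concat (xs ∷ xss) = trans (length-++ xs) (cong (length xs +_) (length-concat xss))

∑-cartesianProductWith : ∀ (f : C → ℕ) (g : A → B → C) xs ys →
  ∑ f (cartesianProductWith g xs ys) ≡ ∑[ x ∈ xs ] ∑[ y ∈ ys ] f (g x y)
∑-cartesianProductWith f g []       ys = refl
∑-cartesianProductWith f g (x ∷ xs) ys =
  trans (∑-++ f (map (g x) ys) _) (cong₂ _+_ (∑-map f (g x) ys) (∑-cartesianProductWith f g xs ys))

length≡∑1 : ∀ (xs : List A) → length xs ≡ ∑[ _ ∈ xs ] 1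
length≡∑1 xs = sym (trans (∑-const xs 1) (*-identityʳ (length xs)))

length-filter≡∑𝟙 : ∀ {P : A → Set} (P? : ∀ x → Dec (P x)) xs → length (filter P? xs) ≡ ∑[ x ∈ xs ] 𝟙 (P? x)
length-filter≡∑𝟙 P? []       = refl
length-filter≡∑𝟙 P? (x ∷ xs) with P? x
... | yes _ = cong suc (length-filter≡∑𝟙 P? xs)
... | no _  = length-filter≡∑𝟙 P? xs

∑-+ : ∀ (f g : A → ℕ) xs → ∑[ x ∈ xs ] (f x + g x) ≡ ∑ f xs + ∑ g xs
∑-+ f g []       = refl
∑-+ f g (x ∷ xs) = trans (cong (f x + g x +_) (∑-+ f g xs)) (interchange (f x) (g x) (∑ f xs) (∑ g xs))

∑-∑<-comm : ∀ N (f : ℕ → A → ℕ) xs → ∑[ x ∈ xs ] ∑[ s < N ] f s x ≡ ∑[ s < N ] ∑[ x ∈ xs ] f s x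
∑-∑<-comm zero    f xs = trans (∑-const xs 0) (*-zeroʳ (length xs))
∑-∑<-comm (suc N) f xs = trans (∑-+ _ (f N) xs) (cong (_+ ∑ (f N) xs) (∑-∑<-comm N f xs))

∑<-cong : ∀ N {f g : ℕ → ℕ} → (∀ s → s < N → f s ≡ g s) → ∑< N f ≡ ∑< N g
∑<-cong zero    f≗g = refl
∑<-cong (suc N) f≗g = cong₂ _+_ (∑<-cong N (λ s s<N → f≗g s (m≤n⇒m≤1+n s<N))) (f≗g N ≤-refl)

∑<-const : ∀ N c → ∑[ _ < N ] c ≡ N * c
∑<-const zero    c = refl
∑<-const (suc N) c = trans (cong (_+ c) (∑<-const N c)) (+-comm (N * c) c)

∑<-𝟙-unique : ∀ {P : ℕ → Set} (P? : ∀ s → Dec (P s)) N s₀ → s₀ < N → P s₀ →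
  (∀ s → s < N → P s → s ≡ s₀) → ∑[ s < N ] 𝟙 (P? s) ≡ 1
∑<-𝟙-unique P? (suc N) s₀ s₀<1+N Ps₀ unique with s₀ ≟ N
... | yes refl = cong₂ _+_ below (𝟙-yes (P? s₀) Ps₀)
  where
  below : ∑[ s < s₀ ] 𝟙 (P? s) ≡ 0
  below = trans (∑<-cong s₀ (λ s s<s₀ → 𝟙-no (P? s) (λ Ps → <-irrefl (unique s (m≤n⇒m≤1+n s<s₀) Ps) s<s₀)))
                (trans (∑<-const s₀ 0) (*-zeroʳ s₀))
... | no s₀≢N = cong₂ _+_
  (∑<-𝟙-unique P? N s₀ (≤∧≢⇒< (s≤s⁻¹ s₀<1+N) s₀≢N) Ps₀ (λ s s<N → unique s (m≤n⇒m≤1+n s<N)))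
  (𝟙-no (P? N) (λ PN → s₀≢N (sym (unique N ≤-refl PN))))

Unique-⊆⇒length≤ : ∀ {xs ys : List A} → Unique xs → xs ⊆ ys → length xs ≤ length ys
Unique-⊆⇒length≤ {xs = []}     _            _    = z≤n
Unique-⊆⇒length≤ {xs = x ∷ xs} (x∉xs ∷ uxs) x∷xs⊆ys with ∈-∃++ (x∷xs⊆ys (here refl))
... | as , bs , refl = begin
  suc (length xs)            ≤⟨ s≤s (Unique-⊆⇒length≤ uxs xs⊆as++bs) ⟩
  suc (length (as ++ bs))    ≡⟨ cong suc (length-++ as) ⟩
  suc (length as + length bs) ≡⟨ +-suc (length as) (length bs) ⟨
  length as + length (x ∷ bs) ≡⟨ length-++ as ⟨
  length (as ++ x ∷ bs)      ∎
  where
  open ≤-Reasoning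
  xs⊆as++bs : xs ⊆ as ++ bs
  xs⊆as++bs {z} z∈xs with ∈-++⁻ as (x∷xs⊆ys (there z∈xs))
  ... | inj₁ z∈as             = ∈-++⁺ˡ z∈as
  ... | inj₂ (here refl)      = ⊥-elim (All.lookup x∉xs z∈xs refl)
  ... | inj₂ (there z∈bs)     = ∈-++⁺ʳ as z∈bs

Unique-⊆-antisym⇒length≡ : ∀ {xs ys : List A} → Unique xs → Unique ys → xs ⊆ ys → ys ⊆ xs →
  length xs ≡ length ys
Unique-⊆-antisym⇒length≡ uxs uys xs⊆ys ys⊆xs =
  ≤-antisym (Unique-⊆⇒length≤ uxs xs⊆ys) (Unique-⊆⇒length≤ uys ys⊆xs)

AllPairs-map-on : ∀ {P : A → Set} {R S : A → A → Set} {xs} → (∀ {x y} → P x → P y → R x y → S x y) →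
  All P xs → AllPairs R xs → AllPairs S xs
AllPairs-map-on f []         []         = []
AllPairs-map-on f (px ∷ pxs) (rx ∷ rxs) = All.zipWith (λ (py , r) → f px py r) (pxs , rx) ∷ AllPairs-map-on f pxs rxs

≢[]⇒0<length : ∀ {w : List A} → w ≢ [] → 0 < length w
≢[]⇒0<length {w = []}    w≢[] = ⊥-elim (w≢[] refl)
≢[]⇒0<length {w = _ ∷ _} _    = s≤s z≤n

++-prefix : ∀ (u u′ : List A) {a b} → length u ≤ length u′ → u ++ a ≡ u′ ++ b →
  ∃ λ y → u′ ≡ u ++ y × a ≡ y ++ b
++-prefix []      u′       _         e = u′ , refl , e
++-prefix (x ∷ u) (x′ ∷ u′) (s≤s |u|≤) e with ++-prefix u u′ |u|≤ (∷-injectiveʳ e)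
... | y , u′≡u++y , a≡y++b = y , cong₂ _∷_ (sym (∷-injectiveˡ e)) u′≡u++y , a≡y++b

map-≡-++ : ∀ (f : A → B) v y {b} → map f v ≡ y ++ b → ∃₂ λ x x′ → v ≡ x ++ x′ × y ≡ map f x
map-≡-++ f v       []      e = [] , v , refl , refl
map-≡-++ f (z ∷ v) (_ ∷ y) e with map-≡-++ f v y (∷-injectiveʳ e)
... | x , x′ , v≡x++x′ , y≡fx = z ∷ x , x′ , cong (z ∷_) v≡x++x′ , cong₂ _∷_ (sym (∷-injectiveˡ e)) y≡fx

drop-length-++ : ∀ (u w : List A) → drop (length u) (u ++ w) ≡ w
drop-length-++ []      w = refl
drop-length-++ (_ ∷ u) w = drop-length-++ u w

IsFirstMinimiser : (ℕ → ℕ) → ℕ → ℕ → Set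
IsFirstMinimiser f N t = t ≤ N × (∀ k → k < t → f t < f k) × (∀ k → k ≤ N → f t ≤ f k)

firstMinimiser : ∀ f N → ∃ (IsFirstMinimiser f N)
firstMinimiser f zero = 0 , z≤n , (λ _ ()) , (λ { _ z≤n → ≤-refl })
firstMinimiser f (suc N) with firstMinimiser f N
... | t , t≤N , before , upToN with f (suc N) <? f t
...   | yes fN<ft = suc N , ≤-refl , (λ k k<1+N → <-≤-trans fN<ft (upToN k (s≤s⁻¹ k<1+N))) , everywhere
  where
  everywhere : ∀ k → k ≤ suc N → f (suc N) ≤ f k
  everywhere k k≤1+N with m≤n⇒m<n∨m≡n k≤1+N
  ... | inj₁ k<1+N = ≤-trans (<⇒≤ fN<ft) (upToN k (s≤s⁻¹ k<1+N))
  ... | inj₂ refl = ≤-refl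
...   | no fN≮ft = t , m≤n⇒m≤1+n t≤N , before , everywhere
  where
  everywhere : ∀ k → k ≤ suc N → f t ≤ f k
  everywhere k k≤1+N with m≤n⇒m<n∨m≡n k≤1+N
  ... | inj₁ k<1+N = upToN k (s≤s⁻¹ k<1+N)
  ... | inj₂ refl = ≮⇒≥ fN≮ft

firstMinimiser-unique : ∀ {f N t₁ t₂} → IsFirstMinimiser f N t₁ → IsFirstMinimiser f N t₂ → t₁ ≡ t₂
firstMinimiser-unique {t₁ = t₁} {t₂} (t₁≤N , before₁ , min₁) (t₂≤N , before₂ , min₂) with <-cmp t₁ t₂
... | tri< t₁<t₂ _ _ = ⊥-elim (<⇒≱ (before₂ t₁ t₁<t₂) (min₁ t₂ t₂≤N))
... | tri≈ _ t₁≡t₂ _ = t₁≡t₂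
... | tri> _ _ t₂<t₁ = ⊥-elim (<⇒≱ (before₁ t₂ t₂<t₁) (min₂ t₁ t₁≤N))

≤⇔+≤+ : ∀ c {x y} → x ≤ y ⇔ x + c ≤ y + c
≤⇔+≤+ c = mk⇔ (+-monoˡ-≤ c) (+-cancelʳ-≤ c _ _)

≡⇒≤⇔≤ : ∀ {x x′ y y′} → x ≡ x′ → y ≡ y′ → x ≤ y ⇔ x′ ≤ y′
≡⇒≤⇔≤ refl refl = ⇔.refl

+∸≤+∸⇔ : ∀ {N k t} x y → k ≤ N → t ≤ N → x + (N ∸ t) ≤ y + (N ∸ k) ⇔ x + k ≤ y + t
+∸≤+∸⇔ {N} {k} {t} x y k≤N t≤N = begin
  x + (N ∸ t) ≤ y + (N ∸ k)                      ≈⟨ ≤⇔+≤+ (t + k) ⟩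
  x + (N ∸ t) + (t + k) ≤ y + (N ∸ k) + (t + k)  ≈⟨ ≡⇒≤⇔≤ eqˣ eqʸ ⟩
  x + k + N ≤ y + t + N                          ≈⟨ ≤⇔+≤+ N ⟨
  x + k ≤ y + t                                  ∎
  where
  open ⇔-Reasoning
  shuffle : ∀ x d t k → (x + d) + (t + k) ≡ (x + k) + (d + t)
  shuffle = solve-∀
  eqˣ : (x + (N ∸ t)) + (t + k) ≡ (x + k) + N
  eqˣ = trans (shuffle x (N ∸ t) t k) (cong ((x + k) +_) (m∸n+n≡m t≤N))
  eqʸ : (y + (N ∸ k)) + (t + k) ≡ (y + t) + N
  eqʸ = trans (cong ((y + (N ∸ k)) +_) (+-comm t k))
              (trans (shuffle y (N ∸ k) k t) (cong ((y + t) +_) (m∸n+n≡m k≤N)))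

-- Parking functions by counting

count≤ : ℕ → Word → ℕ
count≤ j []      = 0
count≤ j (x ∷ w) = 𝟙 (x ≤? j) + count≤ j w

count≤-↭ : ∀ j {v w} → v ↭ w → count≤ j v ≡ count≤ j w
count≤-↭ j Perm.refl          = refl
count≤-↭ j (Perm.prep x v↭w)  = cong (𝟙 (x ≤? j) +_) (count≤-↭ j v↭w)
count≤-↭ j (Perm.swap x y v↭w) =
  trans (x∙yz≈y∙xz (𝟙 (x ≤? j)) (𝟙 (y ≤? j)) _)
        (cong (λ c → 𝟙 (y ≤? j) + (𝟙 (x ≤? j) + c)) (count≤-↭ j v↭w))
count≤-↭ j (Perm.trans u↭v v↭w) = trans (count≤-↭ j u↭v) (count≤-↭ j v↭w)

count≤≤length : ∀ j w → count≤ j w ≤ length w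
count≤≤length j []      = z≤n
count≤≤length j (x ∷ w) with x ≤? j
... | yes _ = s≤s (count≤≤length j w)
... | no _  = m≤n⇒m≤1+n (count≤≤length j w)

count≤-all : ∀ {j w} → All (_≤ j) w → count≤ j w ≡ length w
count≤-all         []                = refl
count≤-all {j} {x ∷ w} (x≤j ∷ w≤j) =
  trans (cong (_+ count≤ j w) (𝟙-yes (x ≤? j) x≤j)) (cong suc (count≤-all w≤j))

count≤-none : ∀ {j w} → All (j <_) w → count≤ j w ≡ 0
count≤-none         []                = refl
count≤-none {j} {x ∷ w} (j<x ∷ j<w) = cong₂ _+_ (𝟙-no (x ≤? j) (<⇒≱ j<x)) (count≤-none j<w)

length≤count≤⇒all : ∀ j w → length w ≤ count≤ j w → All (_≤ j) w
length≤count≤⇒all j []      _ = []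
length≤count≤⇒all j (x ∷ w) h with x ≤? j
... | yes x≤j = x≤j ∷ length≤count≤⇒all j w (s≤s⁻¹ h)
... | no _    = ⊥-elim (<⇒≱ h (count≤≤length j w))

ParkingByCount : ℕ → Word → Set
ParkingByCount n w = length w ≡ n × Positive w × (∀ j → j ≤ n → j ≤ count≤ j w)

ParkingByCount⇒≤ : ∀ {n w} → ParkingByCount n w → All (_≤ n) w
ParkingByCount⇒≤ {n} {w} (refl , _ , enough) = length≤count≤⇒all n w (enough n ≤-refl)

Staircase : ℕ → List ℕ → Set
Staircase k []       = ⊤
Staircase k (x ∷ xs) = x ≤ suc k × Staircase (suc k) xs

Staircase⇔lookup : ∀ k s → Staircase k s ⇔ (∀ (i : Fin (length s)) → lookup s i ≤ suc (k + toℕ i))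
Staircase⇔lookup k s = mk⇔ (to k s) (from k s)
  where
  to : ∀ k s → Staircase k s → ∀ (i : Fin (length s)) → lookup s i ≤ suc (k + toℕ i)
  to k (x ∷ xs) (x≤ , _)  fzero    = subst (λ m → x ≤ suc m) (sym (+-identityʳ k)) x≤
  to k (x ∷ xs) (_ , xs≤) (fsuc i) = subst (λ m → lookup xs i ≤ suc m) (sym (+-suc k (toℕ i))) (to (suc k) xs xs≤ i)
  from : ∀ k s → (∀ (i : Fin (length s)) → lookup s i ≤ suc (k + toℕ i)) → Staircase k s
  from k []       _  = tt
  from k (x ∷ xs) s≤ = subst (λ m → x ≤ suc m) (+-identityʳ k) (s≤ fzero)
    , from (suc k) xs (λ i → subst (λ m → lookup xs i ≤ suc m) (+-suc k (toℕ i)) (s≤ (fsuc i)))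

Staircase⇒count≤ : ∀ k s → Staircase k s → ∀ j → j ≤ length s → j ≤ count≤ (k + j) s
Staircase⇒count≤ k s        _          zero    _         = z≤n
Staircase⇒count≤ k (x ∷ xs) (x≤ , xs≤) (suc j) (s≤s j≤) with x ≤? (k + suc j)
... | yes _ = s≤s (subst (λ m → j ≤ count≤ m xs) (sym (+-suc k j)) (Staircase⇒count≤ (suc k) xs xs≤ j j≤))
... | no x≰ = ⊥-elim (x≰ (≤-trans x≤ (subst (suc k ≤_) (sym (+-suc k j)) (s≤s (m≤m+n k j)))))

sorted-count≤⇒Staircase : ∀ k s → Linked _≤_ s → (∀ j → j ≤ length s → j ≤ count≤ (k + j) s) → Staircase k s
sorted-count≤⇒Staircase k []       _      _      = tt
sorted-count≤⇒Staircase k (x ∷ xs) sorted enough =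
  x≤1+k , sorted-count≤⇒Staircase (suc k) xs (Linked.tail sorted) enough′
  where
  x≤1+k : x ≤ suc k
  x≤1+k with x ≤? suc k
  ... | yes x≤ = x≤
  ... | no x≰  = ⊥-elim (<⇒≱ one≤ (≤-reflexive (count≤-none later)))
    where
    later : All (suc k <_) xs
    later with Linked⇒AllPairs ≤-trans sorted
    ... | x≤xs ∷ _ = All.map (<-≤-trans (≰⇒> x≰)) x≤xs
    one≤ : 1 ≤ count≤ (suc k) xs
    one≤ with enough 1 (s≤s z≤n)
    ... | one≤count rewrite +-comm k 1 | 𝟙-no (x ≤? suc k) x≰ = one≤count
  enough′ : ∀ j → j ≤ length xs → j ≤ count≤ (suc k + j) xs
  enough′ j j≤ with enough (suc j) (s≤s j≤)
  ... | j+1≤ rewrite +-suc k j | 𝟙-yes (x ≤? suc (k + j)) (≤-trans x≤1+k (s≤s (m≤m+n k j))) = s≤s⁻¹ j+1≤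

IsParkingFunction⇔ParkingByCount : ∀ n w → IsParkingFunction n w ⇔ ParkingByCount n w
IsParkingFunction⇔ParkingByCount n w = mk⇔ to from
  where
  length-sort : length (sort w) ≡ length w
  length-sort = ↭-length (sort-↭ w)
  count≤-sort : ∀ j → count≤ j (sort w) ≡ count≤ j w
  count≤-sort j = count≤-↭ j (sort-↭ w)
  to : IsParkingFunction n w → ParkingByCount n w
  to (refl , bounds , staircase) = refl , All.map proj₁ bounds , λ j j≤n →
    subst (j ≤_) (count≤-sort j)
      (Staircase⇒count≤ 0 (sort w) (Equivalence.from (Staircase⇔lookup 0 (sort w)) staircase) j
        (subst (j ≤_) (sym length-sort) j≤n))
  from : ParkingByCount n w → IsParkingFunction n w
  from pf@(refl , positive , enough) = refl , All.zip (positive , ParkingByCount⇒≤ pf) ,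
    Equivalence.to (Staircase⇔lookup 0 (sort w)) (sorted-count≤⇒Staircase 0 (sort w) (sort-↗ w)
      (λ j j≤ → subst (j ≤_) (sym (count≤-sort j)) (enough j (subst (j ≤_) length-sort j≤))))

parkingByCount? : ∀ n w → Dec (ParkingByCount n w)
parkingByCount? n w = (length w ≟ n) ×-dec (All.all? (1 ≤?_) w ×-dec
  map′ (λ enough j j≤n → enough (s≤s j≤n)) (λ enough {j} j<1+n → enough j (s≤s⁻¹ j<1+n))
       (allUpTo? (λ j → j ≤? count≤ j w) (suc n)))

-- Enumerating words

interval : ℕ → ℕ → List ℕ
interval a zero    = []
interval a (suc k) = a ∷ interval (suc a) k

∈-interval⁻ : ∀ {a k x} → x ∈ interval a k → a ≤ x × x < a + k
∈-interval⁻ {a} {suc k} (here refl) = ≤-refl , m<m+n a (s≤s z≤n)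
∈-interval⁻ {a} {suc k} {x} (there x∈) with ∈-interval⁻ {suc a} {k} x∈
... | a<x , x<1+a+k = <⇒≤ a<x , subst (x <_) (sym (+-suc a k)) x<1+a+k

∈-interval⁺ : ∀ {a k x} → a ≤ x → x < a + k → x ∈ interval a k
∈-interval⁺ {a} {zero}  a≤x x<a+0 = ⊥-elim (<⇒≱ x<a+0 (subst (_≤ _) (sym (+-identityʳ a)) a≤x))
∈-interval⁺ {a} {suc k} {x} a≤x x<a+1+k with a ≟ x
... | yes refl = here refl
... | no a≢x   = there (∈-interval⁺ (≤∧≢⇒< a≤x a≢x) (subst (x <_) (+-suc a k) x<a+1+k))

interval-unique : ∀ a k → Unique (interval a k)
interval-unique a zero    = []
interval-unique a (suc k) =
  All.tabulate (λ a∈ a≡ → <-irrefl a≡ (proj₁ (∈-interval⁻ a∈))) ∷ interval-unique (suc a) k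

length-interval : ∀ a k → length (interval a k) ≡ k
length-interval a zero    = refl
length-interval a (suc k) = cong suc (length-interval (suc a) k)

interval-++ : ∀ a k l → interval a (k + l) ≡ interval a k ++ interval (a + k) l
interval-++ a zero    l = cong (λ b → interval b l) (sym (+-identityʳ a))
interval-++ a (suc k) l = cong (a ∷_)
  (trans (interval-++ (suc a) k l) (cong (λ b → interval (suc a) k ++ interval b l) (sym (+-suc a k))))

map-interval : ∀ (f : ℕ → ℕ) a b k → (∀ i → i < k → f (a + i) ≡ b + i) → map f (interval a k) ≡ interval b k
map-interval f a b zero    f≗ = refl
map-interval f a b (suc k) f≗ = cong₂ _∷_
  (trans (cong f (sym (+-identityʳ a))) (trans (f≗ 0 (s≤s z≤n)) (+-identityʳ b)))
  (map-interval f (suc a) (suc b) k (λ i i<k → trans (cong f (sym (+-suc a i))) (trans (f≗ (suc i) (s≤s i<k)) (+-suc b i))))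

words : ℕ → ℕ → List Word
words N zero    = [] ∷ []
words N (suc m) = cartesianProductWith _∷_ (interval 1 N) (words N m)

Letters≤ : ℕ → Word → Set
Letters≤ N = All (λ x → 1 ≤ x × x ≤ N)

∈-words⁻ : ∀ N m {w} → w ∈ words N m → length w ≡ m × Letters≤ N w
∈-words⁻ N zero    (here refl) = refl , []
∈-words⁻ N (suc m) w∈ with ∈-cartesianProductWith⁻ _∷_ (interval 1 N) (words N m) w∈
... | x , v , x∈ , v∈ , refl with ∈-words⁻ N m v∈ | ∈-interval⁻ x∈
... | refl , v-letters | 1≤x , x<1+N = refl , (1≤x , s≤s⁻¹ x<1+N) ∷ v-letters

∈-words⁺ : ∀ N {w} → Letters≤ N w → w ∈ words N (length w)
∈-words⁺ N {[]}    []                = here refl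
∈-words⁺ N {x ∷ w} ((1≤x , x≤N) ∷ ws) =
  ∈-cartesianProductWith⁺ _∷_ (∈-interval⁺ 1≤x (s≤s x≤N)) (∈-words⁺ N ws)

words-unique : ∀ N m → Unique (words N m)
words-unique N zero    = [] ∷ []
words-unique N (suc m) = Unique.cartesianProductWith⁺ _∷_ (λ { refl → refl , refl }) (interval-unique 1 N) (words-unique N m)

length-words : ∀ N m → length (words N m) ≡ N ^ m
length-words N zero    = refl
length-words N (suc m) = begin
  length (words N (suc m))                  ≡⟨ length≡∑1 (words N (suc m)) ⟩
  ∑[ _ ∈ words N (suc m) ] 1                 ≡⟨ ∑-cartesianProductWith (λ _ → 1) _∷_ (interval 1 N) (words N m) ⟩
  ∑[ _ ∈ interval 1 N ] ∑[ _ ∈ words N m ] 1 ≡⟨ ∑-cong (interval 1 N) (λ _ _ → sym (length≡∑1 (words N m))) ⟩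
  ∑[ _ ∈ interval 1 N ] length (words N m)   ≡⟨ ∑-const (interval 1 N) _ ⟩
  length (interval 1 N) * length (words N m) ≡⟨ cong₂ _*_ (length-interval 1 N) (length-words N m) ⟩
  N * N ^ m                                  ∎
  where open ≡-Reasoning

parkingFunctions : ℕ → List Word
parkingFunctions n = filter (parkingByCount? n) (words (suc n) n)

parkingFunctions-unique : ∀ n → Unique (parkingFunctions n)
parkingFunctions-unique n = Unique.filter⁺ (parkingByCount? n) (words-unique (suc n) n)

∈-parkingFunctions⁻ : ∀ n {w} → w ∈ parkingFunctions n → ParkingByCount n w
∈-parkingFunctions⁻ n w∈ = proj₂ (∈-filter⁻ (parkingByCount? n) {xs = words (suc n) n} w∈)

∈-parkingFunctions⁺ : ∀ n {w} → ParkingByCount n w → w ∈ parkingFunctions n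
∈-parkingFunctions⁺ n {w} pf@(refl , positive , _) = ∈-filter⁺ (parkingByCount? n) (∈-words⁺ (suc n) letters) pf
  where
  letters : Letters≤ (suc n) w
  letters = All.zipWith (λ (1≤x , x≤n) → 1≤x , m≤n⇒m≤1+n x≤n) (positive , ParkingByCount⇒≤ pf)

-- Pollak's cycle argument

-- The cyclic shift x ↦ x + s (mod s + t) of the letters 1, …, s + t.
rotate : ℕ → ℕ → ℕ → ℕ
rotate s t x with x ≤? t
... | yes _ = x + s
... | no _  = x ∸ t

∑-rotate-interval : ∀ s t (g : ℕ → ℕ) → ∑[ x ∈ interval 1 (s + t) ] g (rotate s t x) ≡ ∑ g (interval 1 (s + t))
∑-rotate-interval s t g = begin
  ∑ (g ∘ rotate s t) (interval 1 (s + t))                            ≡⟨ ∑-map g (rotate s t) (interval 1 (s + t)) ⟨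
  ∑ g (map (rotate s t) (interval 1 (s + t)))                        ≡⟨ cong (∑ g ∘ map (rotate s t)) split ⟩
  ∑ g (map (rotate s t) (interval 1 t ++ interval (1 + t) s))        ≡⟨ cong (∑ g) (map-++ (rotate s t) (interval 1 t) _) ⟩
  ∑ g (map (rotate s t) (interval 1 t) ++ map (rotate s t) (interval (1 + t) s))
    ≡⟨ cong₂ (λ u v → ∑ g (u ++ v)) (map-interval (rotate s t) 1 (1 + s) t low)
                                    (map-interval (rotate s t) (1 + t) 1 s high) ⟩
  ∑ g (interval (1 + s) t ++ interval 1 s)                           ≡⟨ ∑-++ g (interval (1 + s) t) _ ⟩
  ∑ g (interval (1 + s) t) + ∑ g (interval 1 s)                      ≡⟨ +-comm (∑ g (interval (1 + s) t)) _ ⟩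
  ∑ g (interval 1 s) + ∑ g (interval (1 + s) t)                      ≡⟨ ∑-++ g (interval 1 s) _ ⟨
  ∑ g (interval 1 s ++ interval (1 + s) t)                           ≡⟨ cong (∑ g) (interval-++ 1 s t) ⟨
  ∑ g (interval 1 (s + t))                                           ∎
  where
  open ≡-Reasoning
  split : interval 1 (s + t) ≡ interval 1 t ++ interval (1 + t) s
  split = trans (cong (interval 1) (+-comm s t)) (interval-++ 1 t s)
  low : ∀ i → i < t → rotate s t (1 + i) ≡ 1 + s + i
  low i i<t with suc i ≤? t
  ... | yes _   = cong suc (+-comm i s)
  ... | no i≮t  = ⊥-elim (i≮t i<t)
  high : ∀ i → i < s → rotate s t (1 + t + i) ≡ 1 + i
  high i i<s with suc t + i ≤? t
  ... | yes t+i<t = ⊥-elim (<⇒≱ (s≤s (m≤m+n t i)) t+i<t)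
  ... | no _      = trans (cong (_∸ t) (cong suc (+-comm t i))) (trans (+-∸-assoc 1 (m≤n+m t i)) (cong suc (m+n∸n≡m i t)))

∑-rotate-words : ∀ {N} s t m (f : Word → ℕ) → s + t ≡ N →
  ∑[ w ∈ words N m ] f (map (rotate s t) w) ≡ ∑ f (words N m)
∑-rotate-words s t zero    f refl = refl
∑-rotate-words s t (suc m) f refl = begin
  ∑ (f ∘ map (rotate s t)) (words N (suc m))
    ≡⟨ ∑-cartesianProductWith (f ∘ map (rotate s t)) _∷_ (interval 1 N) (words N m) ⟩
  ∑[ x ∈ interval 1 N ] ∑[ w ∈ words N m ] f (rotate s t x ∷ map (rotate s t) w)
    ≡⟨ ∑-cong (interval 1 N) (λ x _ → ∑-rotate-words s t m (λ w → f (rotate s t x ∷ w)) refl) ⟩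
  ∑[ x ∈ interval 1 N ] ∑[ w ∈ words N m ] f (rotate s t x ∷ w)
    ≡⟨ ∑-rotate-interval s t (λ y → ∑[ w ∈ words N m ] f (y ∷ w)) ⟩
  ∑[ x ∈ interval 1 N ] ∑[ w ∈ words N m ] f (x ∷ w)
    ≡⟨ ∑-cartesianProductWith f _∷_ (interval 1 N) (words N m) ⟨
  ∑ f (words N (suc m))
    ∎
  where
  open ≡-Reasoning
  N = s + t

𝟙-rotate-above : ∀ s t k x → k ≤ t → x ≤ s + t →
  𝟙 (rotate s t x ≤? s + k) + 𝟙 (x ≤? t) ≡ 𝟙 (x ≤? k) + 1
𝟙-rotate-above s t k x k≤t x≤s+t with x ≤? t
... | yes _   = cong (_+ 1) (𝟙-cong (x + s ≤? s + k) (x ≤? k)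
                  (⇔.trans (≡⇒≤⇔≤ refl (+-comm s k)) (⇔.sym (≤⇔+≤+ s))))
... | no x≰t = trans (+-identityʳ _) (trans
                  (𝟙-yes (x ∸ t ≤? s + k)
                    (≤-trans (m≤n+o⇒m∸n≤o x t (subst (x ≤_) (+-comm s t) x≤s+t)) (m≤m+n s k)))
                  (cong (_+ 1) (sym (𝟙-no (x ≤? k) (λ x≤k → x≰t (≤-trans x≤k k≤t))))))

𝟙-rotate-below : ∀ s t j x → j < s → 𝟙 (rotate s t x ≤? j) + 𝟙 (x ≤? t) ≡ 𝟙 (x ≤? t + j)
𝟙-rotate-below s t j x j<s with x ≤? t
... | yes x≤t = trans (cong (_+ 1) (𝟙-no (x + s ≤? j) (λ x+s≤j → <⇒≱ j<s (≤-trans (m≤n+m s x) x+s≤j))))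
                      (sym (𝟙-yes (x ≤? t + j) (≤-trans x≤t (m≤m+n t j))))
... | no x≰t  = trans (+-identityʳ _) (𝟙-cong (x ∸ t ≤? j) (x ≤? t + j)
                  (mk⇔ (λ x∸t≤j → subst (_≤ t + j) (m+[n∸m]≡n (<⇒≤ (≰⇒> x≰t))) (+-monoʳ-≤ t x∸t≤j))
                       (m≤n+o⇒m∸n≤o x t)))

count≤-rotate-above : ∀ s t k a → k ≤ t → All (_≤ s + t) a →
  count≤ (s + k) (map (rotate s t) a) + count≤ t a ≡ count≤ k a + length a
count≤-rotate-above s t k []      _   _         = refl
count≤-rotate-above s t k (x ∷ a) k≤t (x≤ ∷ a≤) = begin
  (𝟙 (rotate s t x ≤? s + k) + count≤ (s + k) (map (rotate s t) a)) + (𝟙 (x ≤? t) + count≤ t a)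
    ≡⟨ interchange (𝟙 (rotate s t x ≤? s + k)) _ _ _ ⟩
  (𝟙 (rotate s t x ≤? s + k) + 𝟙 (x ≤? t)) + (count≤ (s + k) (map (rotate s t) a) + count≤ t a)
    ≡⟨ cong₂ _+_ (𝟙-rotate-above s t k x k≤t x≤) (count≤-rotate-above s t k a k≤t a≤) ⟩
  (𝟙 (x ≤? k) + 1) + (count≤ k a + length a)
    ≡⟨ interchange (𝟙 (x ≤? k)) 1 _ _ ⟩
  count≤ k (x ∷ a) + length (x ∷ a)
    ∎
  where open ≡-Reasoning

count≤-rotate-below : ∀ s t j a → j < s → count≤ j (map (rotate s t) a) + count≤ t a ≡ count≤ (t + j) a
count≤-rotate-below s t j []      _   = refl
count≤-rotate-below s t j (x ∷ a) j<s = begin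
  (𝟙 (rotate s t x ≤? j) + count≤ j (map (rotate s t) a)) + (𝟙 (x ≤? t) + count≤ t a)
    ≡⟨ interchange (𝟙 (rotate s t x ≤? j)) _ _ _ ⟩
  (𝟙 (rotate s t x ≤? j) + 𝟙 (x ≤? t)) + (count≤ j (map (rotate s t) a) + count≤ t a)
    ≡⟨ cong₂ _+_ (𝟙-rotate-below s t j x j<s) (count≤-rotate-below s t j a j<s) ⟩
  count≤ (t + j) (x ∷ a)
    ∎
  where open ≡-Reasoning

rotate-positive : ∀ s t {x} → 1 ≤ x → 1 ≤ rotate s t x
rotate-positive s t {x} 1≤x with x ≤? t
... | yes _   = ≤-trans 1≤x (m≤m+n x s)
... | no x≰t = m<n⇒0<n∸m (≰⇒> x≰t)

level : Word → ℕ → ℕ → ℕ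
level a N k = count≤ k a + (N ∸ k)

level-0≡1+level-N : ∀ {n a} → length a ≡ n → Letters≤ (suc n) a → level a (suc n) 0 ≡ suc (level a (suc n) (suc n))
level-0≡1+level-N {n} {a} length-a letters = begin
  count≤ 0 a + suc n            ≡⟨ cong (_+ suc n) (count≤-none (All.map proj₁ letters)) ⟩
  suc n                         ≡⟨ cong suc (trans (sym length-a) (sym (count≤-all (All.map proj₂ letters)))) ⟩
  suc (count≤ (suc n) a)        ≡⟨ cong suc (+-identityʳ _) ⟨
  suc (count≤ (suc n) a + 0)    ≡⟨ cong (λ m → suc (count≤ (suc n) a + m)) (n∸n≡0 n) ⟨
  suc (level a (suc n) (suc n)) ∎
  where open ≡-Reasoning

module _ {n s t : ℕ} {a : Word} (s+t≡1+n : s + t ≡ suc n) (0<t : 0 < t)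
         (length-a : length a ≡ n) (letters : Letters≤ (suc n) a) where

  private
    t≤1+n : t ≤ suc n
    t≤1+n = subst (t ≤_) s+t≡1+n (m≤n+m t s)
    a≤ : All (_≤ s + t) a
    a≤ = All.map (λ {x} bounds → subst (x ≤_) (sym s+t≡1+n) (proj₂ bounds)) letters
    L : ℕ → ℕ
    L = level a (suc n)
    parks-above⇔ : ∀ {k} → k < t → s + k ≤ count≤ (s + k) (map (rotate s t) a) ⇔ L t < L k
    parks-above⇔ {k} k<t = begin
      s + k ≤ count≤ (s + k) (map (rotate s t) a)
        ≈⟨ ≤⇔+≤+ (count≤ t a) ⟩
      s + k + count≤ t a ≤ count≤ (s + k) (map (rotate s t) a) + count≤ t a
        ≈⟨ ≡⇒≤⇔≤ refl rotated ⟩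
      s + k + count≤ t a ≤ count≤ k a + n
        ≈⟨ mk⇔ s≤s s≤s⁻¹ ⟩
      suc (s + k + count≤ t a) ≤ suc (count≤ k a + n)
        ≈⟨ ≡⇒≤⇔≤ eqˡ eqʳ ⟩
      suc (count≤ t a) + k + s ≤ count≤ k a + t + s
        ≈⟨ ≤⇔+≤+ s ⟨
      suc (count≤ t a) + k ≤ count≤ k a + t
        ≈⟨ +∸≤+∸⇔ (suc (count≤ t a)) (count≤ k a) (≤-trans (<⇒≤ k<t) t≤1+n) t≤1+n ⟨
      L t < L k
        ∎
      where
      open ⇔-Reasoning
      rotated : count≤ (s + k) (map (rotate s t) a) + count≤ t a ≡ count≤ k a + n
      rotated = trans (count≤-rotate-above s t k a (<⇒≤ k<t) a≤) (cong (count≤ k a +_) length-a)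
      shuffle : ∀ s k c → suc (s + k + c) ≡ suc c + k + s
      shuffle = solve-∀
      eqˡ : suc (s + k + count≤ t a) ≡ suc (count≤ t a) + k + s
      eqˡ = shuffle s k (count≤ t a)
      eqʳ : suc (count≤ k a + n) ≡ count≤ k a + t + s
      eqʳ = trans (sym (+-suc (count≤ k a) n))
                  (trans (cong (count≤ k a +_) (trans (sym s+t≡1+n) (+-comm s t))) (sym (+-assoc (count≤ k a) t s)))

    parks-below⇔ : ∀ {j} → j < s → j ≤ count≤ j (map (rotate s t) a) ⇔ L t ≤ L (t + j)
    parks-below⇔ {j} j<s = begin
      j ≤ count≤ j (map (rotate s t) a)
        ≈⟨ ≤⇔+≤+ (count≤ t a) ⟩
      j + count≤ t a ≤ count≤ j (map (rotate s t) a) + count≤ t a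
        ≈⟨ ≡⇒≤⇔≤ refl (count≤-rotate-below s t j a j<s) ⟩
      j + count≤ t a ≤ count≤ (t + j) a
        ≈⟨ ≤⇔+≤+ t ⟩
      j + count≤ t a + t ≤ count≤ (t + j) a + t
        ≈⟨ ≡⇒≤⇔≤ (shuffle j (count≤ t a) t) refl ⟩
      count≤ t a + (t + j) ≤ count≤ (t + j) a + t
        ≈⟨ +∸≤+∸⇔ (count≤ t a) (count≤ (t + j) a) t+j≤1+n t≤1+n ⟨
      L t ≤ L (t + j)
        ∎
      where
      open ⇔-Reasoning
      t+j≤1+n : t + j ≤ suc n
      t+j≤1+n = subst (t + j ≤_) (trans (+-comm t s) s+t≡1+n) (+-monoʳ-≤ t (<⇒≤ j<s))
      shuffle : ∀ j c t → j + c + t ≡ c + (t + j)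
      shuffle = solve-∀

  parkingRotation⇔firstMinimiser : ParkingByCount n (map (rotate s t) a) ⇔ IsFirstMinimiser L (suc n) t
  parkingRotation⇔firstMinimiser = mk⇔ to from
    where
    to : ParkingByCount n (map (rotate s t) a) → IsFirstMinimiser L (suc n) t
    to (_ , _ , enough) = t≤1+n , before , everywhere
      where
      before : ∀ k → k < t → L t < L k
      before k k<t = Equivalence.to (parks-above⇔ k<t) (enough (s + k) (s≤s⁻¹ (subst (s + k <_) s+t≡1+n (+-monoʳ-< s k<t))))
      everywhere : ∀ k → k ≤ suc n → L t ≤ L k
      everywhere k k≤1+n with k <? t | m≤n⇒m<n∨m≡n k≤1+n
      ... | yes k<t | _         = <⇒≤ (before k k<t)
      ... | no k≮t | inj₁ k<1+n =
        subst (λ i → L t ≤ L i) (m+[n∸m]≡n t≤k) (Equivalence.to (parks-below⇔ j<s) (enough j j≤n))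
        where
        t≤k = ≮⇒≥ k≮t
        j = k ∸ t
        j<s : j < s
        j<s = +-cancelˡ-< t j s (subst₂ _<_ (sym (m+[n∸m]≡n t≤k)) (sym (trans (+-comm t s) s+t≡1+n)) k<1+n)
        j≤n : j ≤ n
        j≤n = <⇒≤ (<-≤-trans j<s (s≤s⁻¹ (subst (s <_) s+t≡1+n (m<m+n s 0<t))))
      ... | no _   | inj₂ refl  = s≤s⁻¹ (subst (L t <_) (level-0≡1+level-N length-a letters) (before 0 0<t))
    from : IsFirstMinimiser L (suc n) t → ParkingByCount n (map (rotate s t) a)
    from (_ , before , everywhere) = trans (length-map (rotate s t) a) length-a ,
      map⁺ (All.map (rotate-positive s t ∘ proj₁) letters) , enough
      where
      enough : ∀ i → i ≤ n → i ≤ count≤ i (map (rotate s t) a)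
      enough i i≤n with s ≤? i
      ... | yes s≤i = subst (λ m → m ≤ count≤ m (map (rotate s t) a)) (m+[n∸m]≡n s≤i)
                        (Equivalence.from (parks-above⇔ k<t) (before (i ∸ s) k<t))
        where
        k<t : i ∸ s < t
        k<t = +-cancelˡ-< s (i ∸ s) t (subst₂ _<_ (sym (m+[n∸m]≡n s≤i)) (sym s+t≡1+n) (s≤s i≤n))
      ... | no s≰i  = Equivalence.from (parks-below⇔ (≰⇒> s≰i)) (everywhere (t + i) t+i≤1+n)
        where
        t+i≤1+n : t + i ≤ suc n
        t+i≤1+n = subst (t + i ≤_) (trans (+-comm t s) s+t≡1+n) (+-monoʳ-≤ t (<⇒≤ (≰⇒> s≰i)))

exactlyOneRotationParks : ∀ n {a} → a ∈ words (suc n) n →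
  ∑[ s < suc n ] 𝟙 (parkingByCount? n (map (rotate s (suc n ∸ s)) a)) ≡ 1
exactlyOneRotationParks n {a} a∈ with ∈-words⁻ (suc n) n a∈ | firstMinimiser (level a (suc n)) (suc n)
... | length-a , letters | t₀ , min₀@(t₀≤1+n , _ , everywhere₀) =
  ∑<-𝟙-unique (λ s → parkingByCount? n (map (rotate s (suc n ∸ s)) a)) (suc n) (suc n ∸ t₀) s₀<1+n parks₀ unique
  where
  bridge : ∀ {s} → s < suc n →
    ParkingByCount n (map (rotate s (suc n ∸ s)) a) ⇔ IsFirstMinimiser (level a (suc n)) (suc n) (suc n ∸ s)
  bridge s<1+n = parkingRotation⇔firstMinimiser (m+[n∸m]≡n (<⇒≤ s<1+n)) (m<n⇒0<n∸m s<1+n) length-a letters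
  0<t₀ : 0 < t₀
  0<t₀ = n≢0⇒n>0 λ t₀≡0 → <-irrefl refl (subst (_≤ level a (suc n) (suc n))
    (trans (cong (level a (suc n)) t₀≡0) (level-0≡1+level-N length-a letters)) (everywhere₀ (suc n) ≤-refl))
  s₀<1+n : suc n ∸ t₀ < suc n
  s₀<1+n = ∸-monoʳ-< {m = suc n} {o = 0} 0<t₀ t₀≤1+n
  parks₀ : ParkingByCount n (map (rotate (suc n ∸ t₀) (suc n ∸ (suc n ∸ t₀))) a)
  parks₀ = Equivalence.from (bridge s₀<1+n)
    (subst (IsFirstMinimiser (level a (suc n)) (suc n)) (sym (m∸[m∸n]≡n t₀≤1+n)) min₀)
  unique : ∀ s → s < suc n → ParkingByCount n (map (rotate s (suc n ∸ s)) a) → s ≡ suc n ∸ t₀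
  unique s s<1+n parks = trans (sym (m∸[m∸n]≡n (<⇒≤ s<1+n)))
    (cong (suc n ∸_) (firstMinimiser-unique (Equivalence.to (bridge s<1+n) parks) min₀))

pollak : ∀ n → suc n * length (parkingFunctions n) ≡ suc n ^ n
pollak n = sym (begin
  suc n ^ n
    ≡⟨ length-words (suc n) n ⟨
  length W
    ≡⟨ length≡∑1 W ⟩
  ∑[ _ ∈ W ] 1
    ≡⟨ ∑-cong W (λ _ a∈ → exactlyOneRotationParks n a∈) ⟨
  ∑[ a ∈ W ] ∑[ s < suc n ] 𝟙 (parkingByCount? n (rotation s a))
    ≡⟨ ∑-∑<-comm (suc n) (λ s a → 𝟙 (parkingByCount? n (rotation s a))) W ⟩
  ∑[ s < suc n ] ∑[ a ∈ W ] 𝟙 (parkingByCount? n (rotation s a))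
    ≡⟨ ∑<-cong (suc n) rotationInvariant ⟩
  ∑[ _ < suc n ] length (parkingFunctions n)
    ≡⟨ ∑<-const (suc n) _ ⟩
  suc n * length (parkingFunctions n)
    ∎)
  where
  open ≡-Reasoning
  W = words (suc n) n
  rotation : ℕ → Word → Word
  rotation s = map (rotate s (suc n ∸ s))
  rotationInvariant : ∀ s → s < suc n →
    ∑[ a ∈ W ] 𝟙 (parkingByCount? n (rotation s a)) ≡ length (parkingFunctions n)
  rotationInvariant s s<1+n =
    trans (∑-rotate-words s (suc n ∸ s) n (𝟙 ∘ parkingByCount? n) (m+[n∸m]≡n (<⇒≤ s<1+n)))
          (sym (length-filter≡∑𝟙 (parkingByCount? n) W))

length-parkingFunctions : ∀ m → length (parkingFunctions (suc m)) ≡ (m + 2) ^ m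
length-parkingFunctions m = trans (*-cancelˡ-≡ _ _ (2 + m) (pollak (suc m))) (cong (_^ m) (+-comm 2 m))

length-parkingFunctions-0 : length (parkingFunctions 0) ≡ 1
length-parkingFunctions-0 = trans (sym (*-identityˡ _)) (pollak 0)

-- Connected factorisation

count≤-++ : ∀ j u v → count≤ j (u ++ v) ≡ count≤ j u + count≤ j v
count≤-++ j []      v = refl
count≤-++ j (x ∷ u) v = trans (cong (𝟙 (x ≤? j) +_) (count≤-++ j u v)) (sym (+-assoc (𝟙 (x ≤? j)) _ _))

shift-positive : ∀ k {v} → Positive v → All (k <_) (shift k v)
shift-positive k positive = map⁺ (All.map (m<m+n k) positive)

count≤-shift-below : ∀ {j k v} → j ≤ k → Positive v → count≤ j (shift k v) ≡ 0
count≤-shift-below {k = k} j≤k positive = count≤-none (All.map (≤-<-trans j≤k) (shift-positive k positive))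

count≤-shift : ∀ k j v → count≤ (k + j) (shift k v) ≡ count≤ j v
count≤-shift k j []      = refl
count≤-shift k j (x ∷ v) =
  cong₂ _+_ (𝟙-cong (k + x ≤? k + j) (x ≤? j) (mk⇔ (+-cancelˡ-≤ k x j) (+-monoʳ-≤ k))) (count≤-shift k j v)

length-• : ∀ u v → length (u • v) ≡ length u + length v
length-• u v = trans (length-++ u) (cong (length u +_) (length-map (length u +_) v))

count≤-•-low : ∀ {j} u {v} → j ≤ length u → Positive v → count≤ j (u • v) ≡ count≤ j u
count≤-•-low {j} u {v} j≤ positive =
  trans (count≤-++ j u (shift (length u) v)) (trans (cong (count≤ j u +_) (count≤-shift-below j≤ positive)) (+-identityʳ _))

count≤-•-high : ∀ u v j → count≤ (length u + j) (u • v) ≡ count≤ (length u + j) u + count≤ j v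
count≤-•-high u v j = trans (count≤-++ (length u + j) u (shift (length u) v))
                             (cong (count≤ (length u + j) u +_) (count≤-shift (length u) j v))

ParkingByCount-•⁻ : ∀ {n} u v → Positive v → ParkingByCount n (u • v) →
  ParkingByCount (length u) u × ParkingByCount (length v) v
ParkingByCount-•⁻ {n} u v positive-v (length-uv , positive-uv , enough) =
  (refl , ++⁻ˡ u positive-uv , enough-u) , (refl , positive-v , enough-v)
  where
  k = length u
  k+|v|≡n : k + length v ≡ n
  k+|v|≡n = trans (sym (length-• u v)) length-uv
  enough-u : ∀ j → j ≤ k → j ≤ count≤ j u
  enough-u j j≤k = subst (j ≤_) (count≤-•-low u j≤k positive-v)
                          (enough j (≤-trans j≤k (subst (k ≤_) k+|v|≡n (m≤m+n k _))))
  enough-v : ∀ j → j ≤ length v → j ≤ count≤ j v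
  enough-v j j≤ = +-cancelˡ-≤ k j (count≤ j v) (begin
    k + j                             ≤⟨ enough (k + j) (subst (k + j ≤_) k+|v|≡n (+-monoʳ-≤ k j≤)) ⟩
    count≤ (k + j) (u • v)            ≡⟨ count≤-•-high u v j ⟩
    count≤ (k + j) u + count≤ j v     ≤⟨ +-monoˡ-≤ (count≤ j v) (count≤≤length (k + j) u) ⟩
    k + count≤ j v                    ∎)
    where open ≤-Reasoning

ParkingByCount-•⁺ : ∀ {m n u v} → ParkingByCount m u → ParkingByCount n v → ParkingByCount (m + n) (u • v)
ParkingByCount-•⁺ {m} {n} {u} {v} pf-u@(refl , positive-u , enough-u) (refl , positive-v , enough-v) =
  length-• u v , ++⁺ positive-u (map⁺ (All.map (λ {x} 1≤x → ≤-trans 1≤x (m≤n+m x m)) positive-v)) , enough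
  where
  enough : ∀ j → j ≤ m + n → j ≤ count≤ j (u • v)
  enough j j≤m+n with j ≤? m
  ... | yes j≤m = subst (j ≤_) (sym (count≤-•-low u j≤m positive-v)) (enough-u j j≤m)
  ... | no j≰m  = subst (λ i → i ≤ count≤ i (u • v)) (m+[n∸m]≡n m≤j) (begin
    m + i
      ≤⟨ +-monoʳ-≤ m (enough-v i (+-cancelˡ-≤ m i n (subst (_≤ m + n) (sym (m+[n∸m]≡n m≤j)) j≤m+n))) ⟩
    m + count≤ i v
      ≡⟨ cong (_+ count≤ i v) (count≤-all (All.map (λ x≤m → ≤-trans x≤m (m≤m+n m i)) (ParkingByCount⇒≤ pf-u))) ⟨
    count≤ (m + i) u + count≤ i v
      ≡⟨ count≤-•-high u v i ⟨
    count≤ (m + i) (u • v)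
      ∎)
    where
    open ≤-Reasoning
    m≤j = <⇒≤ (≰⇒> j≰m)
    i = j ∸ m

•-assoc : ∀ u v w → (u • v) • w ≡ u • (v • w)
•-assoc u v w = begin
  (u ++ shift (length u) v) ++ shift (length (u • v)) w
    ≡⟨ ++-assoc u (shift (length u) v) _ ⟩
  u ++ (shift (length u) v ++ shift (length (u • v)) w)
    ≡⟨ cong (λ z → u ++ (shift (length u) v ++ z)) shift-shift ⟩
  u ++ (shift (length u) v ++ shift (length u) (shift (length v) w))
    ≡⟨ cong (u ++_) (map-++ (length u +_) v (shift (length v) w)) ⟨
  u • (v • w)
    ∎
  where
  open ≡-Reasoning
  shift-shift : shift (length (u • v)) w ≡ shift (length u) (shift (length v) w)
  shift-shift = begin
    map (length (u • v) +_) w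
      ≡⟨ map-cong (λ x → trans (cong (_+ x) (length-• u v)) (+-assoc (length u) (length v) x)) w ⟩
    map ((length u +_) ∘ (length v +_)) w
      ≡⟨ map-∘ w ⟩
    shift (length u) (shift (length v) w)
      ∎

•-injectiveʳ : ∀ u {v v′} → u • v ≡ u • v′ → v ≡ v′
•-injectiveʳ u uv≡uv′ = map-injective (+-cancelˡ-≡ (length u) _ _) (++-cancelˡ u _ _ uv≡uv′)

Splittable : Word → Set
Splittable w = ∃₂ λ u v → u ≢ [] × v ≢ [] × Positive u × Positive v × w ≡ u • v

connectedPrefix-≤ : ∀ {u u′ v v′} → length u ≤ length u′ → Connected u′ → u ≢ [] →
  Positive u → Positive v → u • v ≡ u′ • v′ → u ≡ u′
connectedPrefix-≤ {u} {u′} {v} |u|≤|u′| connected-u′ u≢[] positive-u positive-v e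
  with ++-prefix u u′ |u|≤|u′| e
... | []    , u′≡u++[] , _ = sym (trans u′≡u++[] (++-identityʳ u))
... | z ∷ y , u′≡u++y  , shifted-v≡zy++_ with map-≡-++ (length u +_) v (z ∷ y) shifted-v≡zy++_
...   | x , x′ , v≡x++x′ , zy≡shifted-x = ⊥-elim (connected-u′
        (u , x , u≢[] , x≢[] , positive-u , ++⁻ˡ x (subst Positive v≡x++x′ positive-v) ,
         trans u′≡u++y (cong (u ++_) zy≡shifted-x)))
  where
  x≢[] : x ≢ []
  x≢[] x≡[] with trans zy≡shifted-x (cong (shift (length u)) x≡[])
  ... | ()

connectedPrefix-unique : ∀ {u u′ v v′} → Connected u → Connected u′ → u ≢ [] → u′ ≢ [] →
  Positive u → Positive u′ → Positive v → Positive v′ → u • v ≡ u′ • v′ → u ≡ u′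
connectedPrefix-unique {u} {u′} c c′ u≢[] u′≢[] pu pu′ pv pv′ e with ≤-total (length u) (length u′)
... | inj₁ |u|≤|u′| = connectedPrefix-≤ |u|≤|u′| c′ u≢[] pu pv e
... | inj₂ |u′|≤|u| = sym (connectedPrefix-≤ |u′|≤|u| c u′≢[] pu′ pv′ (sym e))

SplitsAt : Word → ℕ → Set
SplitsAt w k = 1 ≤ k × All (k <_) (drop k w)

splitsAt⇒splittable : ∀ {w k} → Positive w → k < length w → SplitsAt w k → Splittable w
splitsAt⇒splittable {w} {k} positive k<|w| (1≤k , k<rest) =
  take k w , map (_∸ k) (drop k w) , prefix≢[] , rest≢[] ,
  take⁺ k positive , map⁺ (All.map m<n⇒0<n∸m k<rest) , sym w≡
  where
  length-prefix : length (take k w) ≡ k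
  length-prefix = trans (length-take k w) (m≤n⇒m⊓n≡m (<⇒≤ k<|w|))
  prefix≢[] : take k w ≢ []
  prefix≢[] e = <⇒≢ 1≤k (trans (sym (cong length e)) length-prefix)
  rest≢[] : map (_∸ k) (drop k w) ≢ []
  rest≢[] e = <⇒≢ (m<n⇒0<n∸m k<|w|)
    (trans (sym (cong length e)) (trans (length-map (_∸ k) (drop k w)) (length-drop k w)))
  w≡ : take k w • map (_∸ k) (drop k w) ≡ w
  w≡ = begin
    take k w ++ shift (length (take k w)) (map (_∸ k) (drop k w))
      ≡⟨ cong (λ m → take k w ++ shift m (map (_∸ k) (drop k w))) length-prefix ⟩
    take k w ++ shift k (map (_∸ k) (drop k w))
      ≡⟨ cong (take k w ++_) (trans (sym (map-∘ (drop k w))) (map-id-local unshift)) ⟩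
    take k w ++ drop k w
      ≡⟨ take++drop≡id k w ⟩
    w
      ∎
    where
    open ≡-Reasoning
    unshift : All (λ x → k + (x ∸ k) ≡ x) (drop k w)
    unshift = All.map (λ k<x → m+[n∸m]≡n (<⇒≤ k<x)) k<rest

splittable⇒splitsAt : ∀ {w} → Splittable w → ∃ λ k → k < length w × SplitsAt w k
splittable⇒splitsAt (u , v , u≢[] , v≢[] , _ , positive-v , refl) =
  length u , subst (length u <_) (sym (length-• u v)) (m<m+n (length u) (≢[]⇒0<length v≢[])) ,
  ≢[]⇒0<length u≢[] ,
  subst (All (length u <_)) (sym (drop-length-++ u _)) (shift-positive (length u) positive-v)

splittable? : ∀ w → Positive w → Dec (Splittable w)
splittable? w positive =
  map′ (λ (k , k<|w| , splitsAt) → splitsAt⇒splittable positive k<|w| splitsAt) splittable⇒splitsAt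
       (anyUpTo? (λ k → (1 ≤? k) ×-dec All.all? (k <?_) (drop k w)) (length w))

ConnectedFactorisation : Word → Set
ConnectedFactorisation w = ∃₂ λ u v →
  Connected u × u ≢ [] × ParkingByCount (length u) u × ParkingByCount (length v) v × w ≡ u • v

factorise : ∀ {w} → w ≢ [] → ParkingByCount (length w) w → ConnectedFactorisation w
factorise = go _ ≤-refl
  where
  go : ∀ N {w} → length w ≤ N → w ≢ [] → ParkingByCount (length w) w → ConnectedFactorisation w
  go zero    {[]} _ w≢[] _ = ⊥-elim (w≢[] refl)
  go (suc N) {w} |w|≤ w≢[] pf with splittable? w (proj₁ (proj₂ pf))
  ... | no connected = w , [] , connected , w≢[] , pf , (refl , [] , λ { _ z≤n → z≤n }) , sym (++-identityʳ w)
  ... | yes (u₁ , u₂ , u₁≢[] , u₂≢[] , _ , positive-u₂ , refl) with ParkingByCount-•⁻ u₁ u₂ positive-u₂ pf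
  ...   | pf₁ , pf₂ with go N (s≤s⁻¹ (<-≤-trans |u₁|<|w| |w|≤)) u₁≢[] pf₁
    where
    |u₁|<|w| : length u₁ < length (u₁ • u₂)
    |u₁|<|w| = subst (length u₁ <_) (sym (length-• u₁ u₂)) (m<m+n (length u₁) (≢[]⇒0<length u₂≢[]))
  ...     | u , v₁ , connected , u≢[] , pf-u , pf-v₁ , refl =
    u , v₁ • u₂ , connected , u≢[] , pf-u ,
    subst (λ m → ParkingByCount m (v₁ • u₂)) (sym (length-• v₁ u₂)) (ParkingByCount-•⁺ pf-v₁ pf₂) ,
    •-assoc u v₁ u₂

-- The generating function

module _ (c : ℕ → ℕ) (counts : ∀ n → IsNumberOfConnectedPF (suc n) (c (suc n))) where

  -- The empty word is vacuously Connected and c 0 is unconstrained, so length 0 is left out.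
  connectedPFs : ℕ → List Word
  connectedPFs zero    = []
  connectedPFs (suc m) = proj₁ (counts m)

  connectedPFs-unique : ∀ m → Unique (connectedPFs m)
  connectedPFs-unique zero    = []
  connectedPFs-unique (suc m) = proj₁ (proj₂ (counts m))

  length-connectedPFs : ∀ m → 0 < m → length (connectedPFs m) ≡ c m
  length-connectedPFs (suc m) _ = proj₂ (proj₂ (proj₂ (counts m)))

  ∈-connectedPFs⁻ : ∀ m {u} → u ∈ connectedPFs m → ParkingByCount m u × Connected u × u ≢ []
  ∈-connectedPFs⁻ (suc m) {u} u∈ with Equivalence.to (proj₁ (proj₂ (proj₂ (counts m))) u) u∈
  ... | pf , connected with Equivalence.to (IsParkingFunction⇔ParkingByCount (suc m) u) pf
  ...   | pf′@(length-u , _) = pf′ , connected , λ u≡[] → 0≢1+n (trans (sym (cong length u≡[])) length-u)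

  length-∈-connectedPFs : ∀ m {u} → u ∈ connectedPFs m → length u ≡ m
  length-∈-connectedPFs m u∈ = proj₁ (proj₁ (∈-connectedPFs⁻ m u∈))

  ∈-connectedPFs⁺ : ∀ {u} → u ≢ [] → ParkingByCount (length u) u → Connected u → u ∈ connectedPFs (length u)
  ∈-connectedPFs⁺ {[]}        u≢[] _  _         = ⊥-elim (u≢[] refl)
  ∈-connectedPFs⁺ {u@(_ ∷ w)} _    pf connected = Equivalence.from (proj₁ (proj₂ (proj₂ (counts (length w)))) u)
    (Equivalence.from (IsParkingFunction⇔ParkingByCount (length u) u) pf , connected)

  connectedPrefixes : ℕ → List Word
  connectedPrefixes n = concat (applyUpTo (λ k → connectedPFs (n ∸ k)) n)

  IsConnectedPrefix : ℕ → Word → Set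
  IsConnectedPrefix n u = ParkingByCount (length u) u × Connected u × u ≢ [] × length u ≤ n

  ∈-connectedPrefixes⁻ : ∀ n {u} → u ∈ connectedPrefixes n → IsConnectedPrefix n u
  ∈-connectedPrefixes⁻ n {u} u∈ with ∈-concat⁻′ (applyUpTo (λ k → connectedPFs (n ∸ k)) n) u∈
  ... | _ , u∈block , block∈ with ∈-applyUpTo⁻ (λ k → connectedPFs (n ∸ k)) block∈
  ...   | k , _ , refl with ∈-connectedPFs⁻ (n ∸ k) u∈block
  ...     | pf@(length-u , _) , connected , u≢[] =
    subst (λ m → ParkingByCount m u) (sym length-u) pf , connected , u≢[] , subst (_≤ n) (sym length-u) (m∸n≤m n k)

  ∈-connectedPrefixes⁺ : ∀ n {u} → u ≢ [] → ParkingByCount (length u) u → Connected u → length u ≤ n →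
    u ∈ connectedPrefixes n
  ∈-connectedPrefixes⁺ n {u} u≢[] pf connected |u|≤n = ∈-concat⁺′
    (subst (λ m → u ∈ connectedPFs m) (sym (m∸[m∸n]≡n |u|≤n)) (∈-connectedPFs⁺ u≢[] pf connected))
    (∈-applyUpTo⁺ (λ k → connectedPFs (n ∸ k)) (∸-monoʳ-< (≢[]⇒0<length u≢[]) |u|≤n))

  connectedPrefixes-unique : ∀ n → Unique (connectedPrefixes n)
  connectedPrefixes-unique n = Unique.concat⁺ (applyUpTo⁺₂ _ n (λ k → connectedPFs-unique (n ∸ k)))
    (AllPairs.applyUpTo⁺₁ _ n disjoint)
    where
    disjoint : ∀ {i j} → i < j → j < n → Disjoint (connectedPFs (n ∸ i)) (connectedPFs (n ∸ j))
    disjoint {i} {j} i<j j<n (u∈i , u∈j) = <⇒≢ i<j (begin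
      i            ≡⟨ m∸[m∸n]≡n (<⇒≤ (<-trans i<j j<n)) ⟨
      n ∸ (n ∸ i)  ≡⟨ cong (n ∸_) (trans (sym (length-∈-connectedPFs (n ∸ i) u∈i)) (length-∈-connectedPFs (n ∸ j) u∈j)) ⟩
      n ∸ (n ∸ j)  ≡⟨ m∸[m∸n]≡n (<⇒≤ j<n) ⟩
      j            ∎)
      where open ≡-Reasoning

  completions : ℕ → Word → List Word
  completions n u = map (u •_) (parkingFunctions (n ∸ length u))

  factorisations : ℕ → List Word
  factorisations n = concat (map (completions n) (connectedPrefixes n))

  factorisations⊆parkingFunctions : ∀ n → factorisations n ⊆ parkingFunctions n
  factorisations⊆parkingFunctions n w∈ with ∈-concat⁻′ (map (completions n) (connectedPrefixes n)) w∈
  ... | _ , w∈block , block∈ with ∈-map⁻ (completions n) block∈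
  ...   | u , u∈ , refl with ∈-map⁻ (u •_) w∈block | ∈-connectedPrefixes⁻ n u∈
  ...     | v , v∈ , refl | pf-u , _ , _ , |u|≤n =
    ∈-parkingFunctions⁺ n (subst (λ m → ParkingByCount m (u • v)) (m+[n∸m]≡n |u|≤n)
      (ParkingByCount-•⁺ pf-u (∈-parkingFunctions⁻ (n ∸ length u) v∈)))

  parkingFunctions⊆factorisations : ∀ n → 0 < n → parkingFunctions n ⊆ factorisations n
  parkingFunctions⊆factorisations n 0<n {w} w∈ with ∈-parkingFunctions⁻ n w∈
  ... | pf@(refl , _) with factorise (λ w≡[] → <⇒≢ 0<n (sym (cong length w≡[]))) pf
  ...   | u , v , connected , u≢[] , pf-u , pf-v , refl =
    ∈-concat⁺′ (∈-map⁺ (u •_) v∈) (∈-map⁺ (completions n) u∈)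
    where
    |u|+|v|≡n : length u + length v ≡ n
    |u|+|v|≡n = sym (length-• u v)
    u∈ : u ∈ connectedPrefixes n
    u∈ = ∈-connectedPrefixes⁺ n u≢[] pf-u connected (subst (length u ≤_) |u|+|v|≡n (m≤m+n (length u) (length v)))
    v∈ : v ∈ parkingFunctions (n ∸ length u)
    v∈ = ∈-parkingFunctions⁺ (n ∸ length u)
      (subst (λ m → ParkingByCount m v) (sym (trans (cong (_∸ length u) (sym |u|+|v|≡n)) (m+n∸m≡n (length u) _))) pf-v)

  factorisations-unique : ∀ n → Unique (factorisations n)
  factorisations-unique n = Unique.concat⁺
    (map⁺ (All.tabulate (λ {u} _ → Unique.map⁺ (•-injectiveʳ u) (parkingFunctions-unique (n ∸ length u)))))
    (AllPairs.map⁺ (AllPairs-map-on disjoint (All.tabulate (∈-connectedPrefixes⁻ n)) (connectedPrefixes-unique n)))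
    where
    positive : ∀ m {v} → v ∈ parkingFunctions m → Positive v
    positive m v∈ = proj₁ (proj₂ (∈-parkingFunctions⁻ m v∈))
    disjoint : ∀ {u u′} → IsConnectedPrefix n u → IsConnectedPrefix n u′ → u ≢ u′ →
      Disjoint (completions n u) (completions n u′)
    disjoint {u} {u′} (pf-u , connected , u≢[] , _) (pf-u′ , connected′ , u′≢[] , _) u≢u′ (w∈ , w∈′)
      with ∈-map⁻ (u •_) w∈ | ∈-map⁻ (u′ •_) w∈′
    ... | v , v∈ , refl | v′ , v′∈ , uv≡u′v′ = u≢u′ (connectedPrefix-unique connected connected′ u≢[] u′≢[]
          (proj₁ (proj₂ pf-u)) (proj₁ (proj₂ pf-u′))
          (positive (n ∸ length u) v∈) (positive (n ∸ length u′) v′∈) uv≡u′v′)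

  length-factorisations : ∀ n → length (factorisations n) ≡ ∑[ k ∈ upTo n ] c (n ∸ k) * length (parkingFunctions k)
  length-factorisations n = begin
    length (concat (map (completions n) U))
      ≡⟨ length-concat (map (completions n) U) ⟩
    ∑ length (map (completions n) U)
      ≡⟨ ∑-map length (completions n) U ⟩
    ∑[ u ∈ U ] length (completions n u)
      ≡⟨ ∑-cong U (λ u _ → length-map (u •_) (parkingFunctions (n ∸ length u))) ⟩
    ∑[ u ∈ U ] P (n ∸ length u)
      ≡⟨ ∑-concat (P ∘ (n ∸_) ∘ length) (applyUpTo prefixes n) ⟩
    ∑[ us ∈ applyUpTo prefixes n ] ∑[ u ∈ us ] P (n ∸ length u)
      ≡⟨ cong (∑ (∑ (P ∘ (n ∸_) ∘ length))) (map-upTo prefixes n) ⟨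
    ∑[ us ∈ map prefixes (upTo n) ] ∑[ u ∈ us ] P (n ∸ length u)
      ≡⟨ ∑-map (∑ (P ∘ (n ∸_) ∘ length)) prefixes (upTo n) ⟩
    ∑[ k ∈ upTo n ] ∑[ u ∈ prefixes k ] P (n ∸ length u)
      ≡⟨ ∑-cong (upTo n) (λ k k∈ → blockSum (∈-upTo⁻ k∈)) ⟩
    ∑[ k ∈ upTo n ] c (n ∸ k) * P k
      ∎
    where
    open ≡-Reasoning
    P : ℕ → ℕ
    P = length ∘ parkingFunctions
    prefixes : ℕ → List Word
    prefixes k = connectedPFs (n ∸ k)
    U = connectedPrefixes n
    blockSum : ∀ {k} → k < n → ∑[ u ∈ prefixes k ] P (n ∸ length u) ≡ c (n ∸ k) * P k
    blockSum {k} k<n = begin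
      ∑[ u ∈ prefixes k ] P (n ∸ length u)
        ≡⟨ ∑-cong (prefixes k) (λ u u∈ → cong (P ∘ (n ∸_)) (length-∈-connectedPFs (n ∸ k) u∈)) ⟩
      ∑[ _ ∈ prefixes k ] P (n ∸ (n ∸ k))
        ≡⟨ ∑-const (prefixes k) _ ⟩
      length (prefixes k) * P (n ∸ (n ∸ k))
        ≡⟨ cong₂ _*_ (length-connectedPFs (n ∸ k) (m<n⇒0<n∸m k<n)) (cong P (m∸[m∸n]≡n (<⇒≤ k<n))) ⟩
      c (n ∸ k) * P k
        ∎

  parkingFunctions-recurrence : ∀ n → 0 < n →
    length (parkingFunctions n) ≡ ∑[ k ∈ upTo n ] c (n ∸ k) * length (parkingFunctions k)
  parkingFunctions-recurrence n 0<n = trans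
    (Unique-⊆-antisym⇒length≡ (parkingFunctions-unique n) (factorisations-unique n)
      (parkingFunctions⊆factorisations n 0<n) (factorisations⊆parkingFunctions n))
    (length-factorisations n)

parkingSeries≡length : ∀ n → parkingSeries n ≡ ℤ.+ length (parkingFunctions n)
parkingSeries≡length zero    = cong ℤ.+_ (sym length-parkingFunctions-0)
parkingSeries≡length (suc m) = cong ℤ.+_ (sym (length-parkingFunctions m))

-- (f *S g) n unfolds to ∑ℤ (λ k → f k ℤ.* g (n ∸ k)) (upTo (suc n)).
∑ℤ : (ℕ → ℤ) → List ℕ → ℤ
∑ℤ f xs = foldr ℤ._+_ (ℤ.+ 0) (map f xs)

∑ℤ-∷ʳ : ∀ f xs x → ∑ℤ f (xs ∷ʳ x) ≡ ∑ℤ f xs ℤ.+ f x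
∑ℤ-∷ʳ f []       x = trans (ℤₚ.+-identityʳ (f x)) (sym (ℤₚ.+-identityˡ (f x)))
∑ℤ-∷ʳ f (y ∷ xs) x = trans (cong (λ z → f y ℤ.+ z) (∑ℤ-∷ʳ f xs x)) (sym (ℤₚ.+-assoc (f y) _ _))

∑ℤ-cong : ∀ {f g : ℕ → ℤ} xs → (∀ x → x ∈ xs → f x ≡ g x) → ∑ℤ f xs ≡ ∑ℤ g xs
∑ℤ-cong []       f≗g = refl
∑ℤ-cong (x ∷ xs) f≗g = cong₂ ℤ._+_ (f≗g x (here refl)) (∑ℤ-cong xs (λ y y∈ → f≗g y (there y∈)))

∑ℤ-neg : ∀ (h : ℕ → ℕ) xs → ∑ℤ (λ k → ℤ.- ℤ.+ h k) xs ≡ ℤ.- ℤ.+ ∑ h xs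
∑ℤ-neg h []       = refl
∑ℤ-neg h (x ∷ xs) = begin
  ℤ.- ℤ.+ h x ℤ.+ ∑ℤ (λ k → ℤ.- ℤ.+ h k) xs ≡⟨ cong (λ z → ℤ.- ℤ.+ h x ℤ.+ z) (∑ℤ-neg h xs) ⟩
  ℤ.- ℤ.+ h x ℤ.+ ℤ.- ℤ.+ ∑ h xs             ≡⟨ ℤₚ.neg-distrib-+ (ℤ.+ h x) (ℤ.+ ∑ h xs) ⟨
  ℤ.- (ℤ.+ h x ℤ.+ ℤ.+ ∑ h xs)               ≡⟨ cong ℤ.-_ (ℤₚ.pos-+ (h x) (∑ h xs)) ⟨
  ℤ.- ℤ.+ (h x + ∑ h xs)                     ∎
  where open ≡-Reasoning

coefficient-parking*[1-conn] : ∀ c m → (parkingSeries *S (oneS -S connSeries c)) (suc m) ≡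
  ℤ.- ℤ.+ (∑[ k ∈ upTo (suc m) ] c (suc m ∸ k) * length (parkingFunctions k))
    ℤ.+ ℤ.+ length (parkingFunctions (suc m))
coefficient-parking*[1-conn] c m = begin
  ∑ℤ term (upTo (suc (suc m)))
    ≡⟨ cong (∑ℤ term) (upTo-∷ʳ (suc m)) ⟨
  ∑ℤ term (upTo (suc m) ∷ʳ suc m)
    ≡⟨ ∑ℤ-∷ʳ term (upTo (suc m)) (suc m) ⟩
  ∑ℤ term (upTo (suc m)) ℤ.+ term (suc m)
    ≡⟨ cong (λ x → x ℤ.+ term (suc m)) (∑ℤ-cong (upTo (suc m)) (λ k k∈ → term-< (∈-upTo⁻ k∈))) ⟩
  ∑ℤ (λ k → ℤ.- ℤ.+ (c (suc m ∸ k) * P k)) (upTo (suc m)) ℤ.+ term (suc m)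
    ≡⟨ cong₂ ℤ._+_ (∑ℤ-neg (λ k → c (suc m ∸ k) * P k) (upTo (suc m))) term-last ⟩
  ℤ.- ℤ.+ (∑[ k ∈ upTo (suc m) ] c (suc m ∸ k) * P k) ℤ.+ ℤ.+ P (suc m)
    ∎
  where
  open ≡-Reasoning
  P : ℕ → ℕ
  P = length ∘ parkingFunctions
  term : ℕ → ℤ
  term k = parkingSeries k ℤ.* (oneS (suc m ∸ k) ℤ.- connSeries c (suc m ∸ k))
  term-< : ∀ {k} → k < suc m → term k ≡ ℤ.- ℤ.+ (c (suc m ∸ k) * P k)
  term-< {k} k<1+m rewrite +-∸-assoc 1 (s≤s⁻¹ k<1+m) | parkingSeries≡length k = begin
    ℤ.+ P k ℤ.* (ℤ.+ 0 ℤ.- ℤ.+ c (suc (m ∸ k)))  ≡⟨ cong (ℤ.+ P k ℤ.*_) (ℤₚ.+-identityˡ _) ⟩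
    ℤ.+ P k ℤ.* ℤ.- ℤ.+ c (suc (m ∸ k))          ≡⟨ ℤₚ.neg-distribʳ-* (ℤ.+ P k) _ ⟨
    ℤ.- (ℤ.+ P k ℤ.* ℤ.+ c (suc (m ∸ k)))        ≡⟨ cong ℤ.-_ (ℤₚ.pos-* (P k) _) ⟨
    ℤ.- ℤ.+ (P k * c (suc (m ∸ k)))              ≡⟨ cong (ℤ.-_ ∘ ℤ.+_) (*-comm (P k) _) ⟩
    ℤ.- ℤ.+ (c (suc (m ∸ k)) * P k)              ∎
  term-last : term (suc m) ≡ ℤ.+ P (suc m)
  term-last rewrite n∸n≡0 m = trans (ℤₚ.*-identityʳ (parkingSeries (suc m))) (parkingSeries≡length (suc m))

mainTheorem5 : (c : ℕ → ℕ) → (∀ n → IsNumberOfConnectedPF (suc n) (c (suc n))) →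
    IsInverse parkingSeries (oneS -S connSeries c)
mainTheorem5 c counts zero    = refl
mainTheorem5 c counts (suc m) = begin
  (parkingSeries *S (oneS -S connSeries c)) (suc m)
    ≡⟨ coefficient-parking*[1-conn] c m ⟩
  ℤ.- ℤ.+ (∑[ k ∈ upTo (suc m) ] c (suc m ∸ k) * P k) ℤ.+ ℤ.+ P (suc m)
    ≡⟨ cong (λ x → ℤ.- ℤ.+ x ℤ.+ ℤ.+ P (suc m)) (parkingFunctions-recurrence c counts (suc m) (s≤s z≤n)) ⟨
  ℤ.- ℤ.+ P (suc m) ℤ.+ ℤ.+ P (suc m)
    ≡⟨ ℤₚ.+-inverseˡ (ℤ.+ P (suc m)) ⟩
  ℤ.+ 0
    ∎
  where
  open ≡-Reasoning
  P : ℕ → ℕ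
  P = length ∘ parkingFunctions
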